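{- Let $n\ge 1$ and let $P_n$ be the path graph with vertices $0,1,\dots,n$ and edges $\{t,t+1\}$ for $0\le t\le n-1$. Let $X=\{\{0,\alpha\}: 1\le \alpha\le n\}\cup\{\{\alpha,n\}: \alpha\in\{0,\dots,n-1\},\ \deg(\alpha)\neq 1\}=\{\{0,\alpha\}:1\le\alpha\le n\}\cup\{\{\alpha,n\}:1\le\alpha\le n-1\}$, a set of $2n-1$ two-element subsets, ordered as \[\{0,1\},\{0,2\},\dots,\{0,n\},\{1,n\},\{2,n\},\dots,\{n-1,n\}.\] Let $D=D_2(P_n)[X,X]$ be the $(2n-1)\times(2n-1)$ principal submatrix of the $2$-Steiner distance matrix of $P_n$ with rows and columns indexed by $X$ in this order. Let $L$ be the Laplacian matrix of the path on $2n-1$ vertices $1,2,\dots,2n-1$ (edges $\{t,t+1\}$), and let $u\in\mathbb{R}^{2n-1}$ be the vector with $1$ in position $n$ and $0$ elsewhere. Then $D$ is invertible and \[D^{ -1}=-L+\frac{1}{n}uu'.\]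
   Context: For a connected graph $G=(V,E)$ and $Y\subseteq V$ with $|Y|\ge 2$, the Steiner distance $d_G(Y)$ is the minimum number of edges among all connected subgraphs of $G$ whose vertex set contains $Y$. The $2$-Steiner distance matrix $D_2(G)$ has rows and columns indexed by $2$-element subsets of $V$, with $(X_1,X_2)$-entry $d_G(X_1\cup X_2)$. The Laplacian $L=(l_{ij})$ of a graph has $l_{ii}$ equal to the degree of vertex $i$, $l_{ij}=-1$ if $i,j$ are adjacent, and $0$ otherwise. $u'$ denotes the transpose of $u$. -}

module Defs where

open import Data.Nat as ℕ using (ℕ; zero; suc; _≤_)
open import Data.Fin as Fin using (Fin; zero; suc; toℕ; inject₁; fromℕ; splitAt)
open import Data.Fin.Subset using (Subset; _∈_; ∣_∣)
open import Data.Sum using (_⊎_; inj₁; inj₂)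
open import Data.Product using (_×_; Σ; ∃; _,_)
open import Data.List using (List; []; _∷_)
open import Data.List.Relation.Unary.All using (All)
open import Data.Integer using (+_; -[1+_])
open import Data.Rational using (ℚ; 0ℚ; 1ℚ; _+_; _*_; -_; _/_)
open import Relation.Binary.PropositionalEquality using (_≡_)
open import Relation.Nullary using (Dec; yes; no; ¬_)
open import Relation.Nullary.Decidable using (_⊎-dec_)
open import Data.Fin using (_≟_)

-- The path graph P_n : vertices 0..n (Fin (suc n)), edges {t,t+1} for
-- t = 0..n-1, the edge {t,t+1} being indexed by t : Fin n.

data Reach {n : ℕ} (Es : Subset n) : Fin (suc n) → Fin (suc n) → Set where
  here : ∀ {a} → Reach Es a a
  fwd  : ∀ {a} t → t ∈ Es → Reach Es a (inject₁ t) → Reach Es a (suc t)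
  bwd  : ∀ {a} t → t ∈ Es → Reach Es a (suc t) → Reach Es a (inject₁ t)

record ConnSubgraph (n : ℕ) : Set where
  field
    Vs   : Subset (suc n)
    Es   : Subset n
    ends : ∀ t → t ∈ Es → (inject₁ t ∈ Vs) × (suc t ∈ Vs)
    conn : ∀ a b → a ∈ Vs → b ∈ Vs → Reach Es a b

open ConnSubgraph public

size : ∀ {n} → ConnSubgraph n → ℕ
size H = ∣ Es H ∣

Contains : ∀ {n} → ConnSubgraph n → List (Fin (suc n)) → Set
Contains H Y = All (λ v → v ∈ Vs H) Y

IsSteinerDist : (n : ℕ) → List (Fin (suc n)) → ℕ → Set
IsSteinerDist n Y k =
  (Σ (ConnSubgraph n) λ H → Contains H Y × size H ≡ k)
  × (∀ (H : ConnSubgraph n) → Contains H Y → k ≤ size H)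

-- The index set X, with n = suc m, listed in the order
-- {0,1},...,{0,n},{1,n},...,{n-1,n}  (2n-1 = n + m entries).

Xpair : (m : ℕ) → Fin (suc m ℕ.+ m) → Fin (suc (suc m)) × Fin (suc (suc m))
Xpair m i with splitAt (suc m) i
... | inj₁ j = zero , suc j
... | inj₂ k = suc (inject₁ k) , fromℕ (suc m)

Xunion : (m : ℕ) → Fin (suc m ℕ.+ m) → Fin (suc m ℕ.+ m) → List (Fin (suc (suc m)))
Xunion m i j with Xpair m i | Xpair m j
... | (a , b) | (c , d) = a ∷ b ∷ c ∷ d ∷ []

Matrix : ℕ → Set
Matrix N = Fin N → Fin N → ℚ

sumFin : ∀ N → (Fin N → ℚ) → ℚ
sumFin zero    f = 0ℚ
sumFin (suc N) f = f zero + sumFin N (λ i → f (suc i))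

_⊗_ : ∀ {N} → Matrix N → Matrix N → Matrix N
_⊗_ {N} A B i j = sumFin N (λ k → A i k * B k j)

identity : ∀ N → Matrix N
identity N i j with i ≟ j
... | yes _ = 1ℚ
... | no  _ = 0ℚ

-- adjacency in the path on vertices 1..N (0-based: Fin N), edges {t,t+1}
pathAdj : ∀ {N} → Fin N → Fin N → Set
pathAdj i j = (suc (toℕ i) ≡ toℕ j) ⊎ (suc (toℕ j) ≡ toℕ i)

pathAdj? : ∀ {N} (i j : Fin N) → Dec (pathAdj i j)
pathAdj? i j = (suc (toℕ i) ℕ.≟ toℕ j) ⊎-dec (suc (toℕ j) ℕ.≟ toℕ i)

adjℚ : ∀ {N} → Fin N → Fin N → ℚ
adjℚ i j with pathAdj? i j
... | yes _ = 1ℚ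
... | no  _ = 0ℚ

degree : ∀ {N} → Fin N → ℚ
degree {N} i = sumFin N (λ j → adjℚ i j)

laplacianPath : ∀ N → Matrix N
laplacianPath N i j with i ≟ j
... | yes _ = degree i
... | no  _ = - adjℚ i j

-- u = e_n in ℚ^{2n-1} (position n in 1-based indexing, i.e. index m = n-1)
uVec : (m : ℕ) → Fin (suc m ℕ.+ m) → ℚ
uVec m i with toℕ i ℕ.≟ m
... | yes _ = 1ℚ
... | no  _ = 0ℚ

claimedInverse : (m : ℕ) → Matrix (suc m ℕ.+ m)
claimedInverse m i j =
  - laplacianPath (suc m ℕ.+ m) i j + ((+ 1) / suc m) * (uVec m i * uVec m j)

toℚMatrix : ∀ {N} → (Fin N → Fin N → ℕ) → Matrix N
toℚMatrix d i j = (+ d i j) / 1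

{-# OPTIONS --safe #-}
module Submission where

-- Index the pairs of X by x = 0, ..., 2m; then X_x = {x ∸ m, suc (x ⊓ m)} and both ends are
-- nondecreasing in x.  The Steiner distance of a vertex set of a path is its largest minus its
-- smallest vertex, so D_xy = suc ((x ⊔ y) ⊓ m) − ((x ⊓ y) ∸ m).  Along a row, consecutive entries
-- differ by D_x(z+1) − D_xz = [x ≤ z] + [z < m] − 1: the slope jumps by +1 at z = x and by −1 at
-- z = m, and it is 0 just outside both ends of the index range.  The path Laplacian takes second
-- differences, so −(D L)_xy = [x = y] − [y = m], while column m of D is constantly n, so
-- (D u u′ / n)_xy = [y = m].  Hence D (−L + u u′ / n) = I, and since both factors are symmetric,
-- transposing gives the product in the other order.

open import Defs

open import Data.Empty using (⊥-elim)
open import Data.Fin as Fin using (Fin; zero; suc; toℕ; inject₁; fromℕ; splitAt)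
open import Data.Fin.Properties
  using (toℕ-injective; toℕ-inject₁; toℕ-fromℕ; toℕ<n; toℕ-↑ˡ; toℕ-↑ʳ; splitAt⁻¹-↑ˡ; splitAt⁻¹-↑ʳ)
open import Data.Fin.Subset using (Subset; outside; inside; _∈_; _⊆_; ∣_∣)
open import Data.Fin.Subset.Properties using (p⊆q⇒∣p∣≤∣q∣)
open import Data.List using ([]; _∷_)
open import Data.List.Membership.Propositional using () renaming (_∈_ to _∈ₗ_)
open import Data.List.Relation.Unary.All as All using (All; []; _∷_)
open import Data.List.Relation.Unary.Any using (here; there)
open import Data.Nat as ℕ using (ℕ; zero; suc; pred; _≤_; _<_; z≤n; s≤s; _∸_; _⊔_; _⊓_)
open import Data.Nat.Properties as ℕ using (≤-refl; ≤-trans; ≤-antisym; ≤-total; ≤⇒≯; m∸n+n≡m; 0∸n≡0)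
open import Data.Product using (_×_; _,_; proj₁; proj₂)
open import Data.Sum using (inj₁; inj₂)
open import Data.Vec using ([]; _∷_; here; there)
open import Relation.Nullary using (yes; no)
open import Relation.Binary.PropositionalEquality
  using (_≡_; _≢_; refl; sym; trans; cong; cong₂; subst; subst₂; module ≡-Reasoning)

module _ {n : ℕ} {Es : Subset n} where

  Reach-trans : ∀ {a b c} → Reach Es a b → Reach Es b c → Reach Es a c
  Reach-trans r here        = r
  Reach-trans r (fwd t e s) = fwd t e (Reach-trans r s)
  Reach-trans r (bwd t e s) = bwd t e (Reach-trans r s)

  Reach-sym : ∀ {a b} → Reach Es a b → Reach Es b a
  Reach-sym here        = here
  Reach-sym (fwd t e r) = Reach-trans (bwd t e here) (Reach-sym r)
  Reach-sym (bwd t e r) = Reach-trans (fwd t e here) (Reach-sym r)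

  EdgesBetween : Fin (suc n) → Fin (suc n) → Set
  EdgesBetween a b = ∀ t → toℕ a ≤ toℕ t → toℕ t < toℕ b → t ∈ Es

  Reach-ascending : ∀ {a b} → toℕ a ≤ toℕ b → EdgesBetween a b → Reach Es a b
  Reach-ascending {a} {b} a≤b = go (toℕ b ∸ toℕ a) b (sym (m∸n+n≡m a≤b))
    where
    go : ∀ d b → toℕ b ≡ d ℕ.+ toℕ a → EdgesBetween a b → Reach Es a b
    go zero    b       b≡a _     = subst (Reach Es a) (toℕ-injective (sym b≡a)) here
    go (suc d) (suc t) b≡a edges =
      fwd t (edges t (subst (toℕ a ≤_) (sym t≡) (ℕ.m≤n+m _ d)) ≤-refl)
        (go d (inject₁ t) (trans (toℕ-inject₁ t) t≡)
          λ s a≤s s<t → edges s a≤s (ℕ.m<n⇒m<1+n (subst (toℕ s <_) (toℕ-inject₁ t) s<t)))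
      where
      t≡ : toℕ t ≡ d ℕ.+ toℕ a
      t≡ = ℕ.suc-injective b≡a

  Reach-crosses : ∀ {a b} → Reach Es a b → EdgesBetween a b
  Reach-crosses here t a≤t t<a = ⊥-elim (≤⇒≯ a≤t t<a)
  Reach-crosses (fwd t′ e r) t a≤t (s≤s t≤t′) with toℕ t ℕ.≟ toℕ t′
  ... | yes t≡t′ = subst (_∈ Es) (sym (toℕ-injective t≡t′)) e
  ... | no  t≢t′ = Reach-crosses r t a≤t (subst (toℕ t <_) (sym (toℕ-inject₁ t′)) (ℕ.≤∧≢⇒< t≤t′ t≢t′))
  Reach-crosses (bwd t′ e r) t a≤t t<t′ =
    Reach-crosses r t a≤t (ℕ.m<n⇒m<1+n (subst (toℕ t <_) (toℕ-inject₁ t′) t<t′))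

interval : ∀ {N} → ℕ → ℕ → Subset N
interval {zero}  _       _       = []
interval {suc N} zero    zero    = outside ∷ interval 0 0
interval {suc N} zero    (suc h) = inside  ∷ interval 0 h
interval {suc N} (suc l) h       = outside ∷ interval l (pred h)

interval⁺ : ∀ {N lo hi} (t : Fin N) → lo ≤ toℕ t → toℕ t < hi → t ∈ interval lo hi
interval⁺ {lo = zero}  {suc h} zero    _         _         = here
interval⁺ {lo = zero}  {suc h} (suc t) _         (s≤s t<h) = there (interval⁺ t z≤n t<h)
interval⁺ {lo = suc l} {suc h} (suc t) (s≤s l≤t) (s≤s t<h) = there (interval⁺ t l≤t t<h)

interval⁻ : ∀ {N lo hi} (t : Fin N) → t ∈ interval lo hi → lo ≤ toℕ t × toℕ t < hi
interval⁻ {lo = zero}  {zero}  (suc t) (there t∈) with interval⁻ t t∈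
... | _ , ()
interval⁻ {lo = zero}  {suc h} zero    here       = z≤n , s≤s z≤n
interval⁻ {lo = zero}  {suc h} (suc t) (there t∈) with interval⁻ t t∈
... | _ , t<h = z≤n , s≤s t<h
interval⁻ {lo = suc l} {suc h} (suc t) (there t∈) with interval⁻ t t∈
... | l≤t , t<h = s≤s l≤t , s≤s t<h
interval⁻ {lo = suc l} {zero}  (suc t) (there t∈) with interval⁻ {lo = l} {0} t t∈
... | _ , ()

∣interval∣ : ∀ {N} lo hi → hi ≤ N → ∣ interval {N} lo hi ∣ ≡ hi ∸ lo
∣interval∣ {zero}  lo      zero    _         = sym (0∸n≡0 lo)
∣interval∣ {suc N} zero    zero    _         = ∣interval∣ {N} 0 0 z≤n
∣interval∣ {suc N} zero    (suc h) (s≤s h≤N) = cong suc (∣interval∣ 0 h h≤N)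
∣interval∣ {suc N} (suc l) zero    _         = trans (∣interval∣ {N} l 0 z≤n) (0∸n≡0 l)
∣interval∣ {suc N} (suc l) (suc h) (s≤s h≤N) = ∣interval∣ l h h≤N

intervalSubgraph : ∀ {n} → ℕ → ℕ → ConnSubgraph n
intervalSubgraph lo hi = record
  { Vs   = interval lo (suc hi)
  ; Es   = interval lo hi
  ; ends = bothEnds
  ; conn = connected
  }
  where
  bothEnds : ∀ t → t ∈ interval lo hi → inject₁ t ∈ interval lo (suc hi) × suc t ∈ interval lo (suc hi)
  bothEnds t t∈ with interval⁻ t t∈
  ... | lo≤t , t<hi =
    interval⁺ (inject₁ t) (subst (lo ≤_) (sym (toℕ-inject₁ t)) lo≤t)
                          (subst (_< suc hi) (sym (toℕ-inject₁ t)) (ℕ.m<n⇒m<1+n t<hi)) ,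
    interval⁺ (suc t) (ℕ.m≤n⇒m≤1+n lo≤t) (s≤s t<hi)
  ascend : ∀ {a b} → a ∈ interval lo (suc hi) → b ∈ interval lo (suc hi) → toℕ a ≤ toℕ b →
           Reach (interval lo hi) a b
  ascend {a} {b} a∈ b∈ a≤b with interval⁻ a a∈ | interval⁻ b b∈
  ... | lo≤a , _ | _ , s≤s b≤hi = Reach-ascending a≤b λ t a≤t t<b →
    interval⁺ t (≤-trans lo≤a a≤t) (ℕ.<-≤-trans t<b b≤hi)
  connected : ∀ a b → a ∈ interval lo (suc hi) → b ∈ interval lo (suc hi) → Reach (interval lo hi) a b
  connected a b a∈ b∈ with ≤-total (toℕ a) (toℕ b)
  ... | inj₁ a≤b = ascend a∈ b∈ a≤b
  ... | inj₂ b≤a = Reach-sym (ascend b∈ a∈ b≤a)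

steinerDist+min≡max : ∀ {n Y k} {lo hi : Fin (suc n)} → IsSteinerDist n Y k → lo ∈ₗ Y → hi ∈ₗ Y →
                   All (λ v → toℕ lo ≤ toℕ v × toℕ v ≤ toℕ hi) Y → k ℕ.+ toℕ lo ≡ toℕ hi
steinerDist+min≡max {n} {k = k} {lo} {hi} ((H , H⊇Y , refl) , minimal) lo∈Y hi∈Y Y⊆[lo,hi] =
  trans (cong (ℕ._+ toℕ lo) k≡hi∸lo) (m∸n+n≡m (proj₂ (All.lookup Y⊆[lo,hi] lo∈Y)))
  where
  hi≤n : toℕ hi ≤ n
  hi≤n = ℕ.≤-pred (toℕ<n hi)
  crossed : interval (toℕ lo) (toℕ hi) ⊆ Es H
  crossed {t} t∈ with interval⁻ t t∈
  ... | lo≤t , t<hi = Reach-crosses (conn H lo hi (All.lookup H⊇Y lo∈Y) (All.lookup H⊇Y hi∈Y)) t lo≤t t<hi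
  k≡hi∸lo : k ≡ toℕ hi ∸ toℕ lo
  k≡hi∸lo = ≤-antisym
    (subst (k ≤_) (∣interval∣ (toℕ lo) (toℕ hi) hi≤n)
      (minimal (intervalSubgraph (toℕ lo) (toℕ hi))
               (All.map (λ (lo≤v , v≤hi) → interval⁺ _ lo≤v (s≤s v≤hi)) Y⊆[lo,hi])))
    (subst (_≤ k) (∣interval∣ (toℕ lo) (toℕ hi) hi≤n) (p⊆q⇒∣p∣≤∣q∣ crossed))

steinerDist-orderedPairs : ∀ {n k} {a b c d : Fin (suc n)} →
                    toℕ a ≤ toℕ b → toℕ b ≤ toℕ d → toℕ a ≤ toℕ c → toℕ c ≤ toℕ d →
                    IsSteinerDist n (a ∷ b ∷ c ∷ d ∷ []) k → k ℕ.+ toℕ a ≡ toℕ d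
steinerDist-orderedPairs a≤b b≤d a≤c c≤d sd =
  steinerDist+min≡max sd (here refl) (there (there (there (here refl))))
    ((≤-refl , a≤d) ∷ (a≤b , b≤d) ∷ (a≤c , c≤d) ∷ (a≤d , ≤-refl) ∷ [])
  where a≤d = ≤-trans a≤b b≤d

steinerDist-swapPairs : ∀ {n k} {a b c d : Fin (suc n)} →
                        IsSteinerDist n (a ∷ b ∷ c ∷ d ∷ []) k → IsSteinerDist n (c ∷ d ∷ a ∷ b ∷ []) k
steinerDist-swapPairs ((H , a∈ ∷ b∈ ∷ c∈ ∷ d∈ ∷ [] , size≡) , minimal) =
  (H , c∈ ∷ d∈ ∷ a∈ ∷ b∈ ∷ [] , size≡) ,
  λ { H′ (c∈′ ∷ d∈′ ∷ a∈′ ∷ b∈′ ∷ []) → minimal H′ (a∈′ ∷ b∈′ ∷ c∈′ ∷ d∈′ ∷ []) }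

lowEnd highEnd : ℕ → ℕ → ℕ
lowEnd  m x = x ∸ m
highEnd m x = suc (x ⊓ m)

lowEnd≤highEnd : ∀ m {x} → x ≤ m ℕ.+ m → lowEnd m x ≤ highEnd m x
lowEnd≤highEnd m {x} x≤2m = ℕ.m≤n⇒m≤1+n (ℕ.⊓-glb (ℕ.m∸n≤m x m)
  (subst (x ∸ m ≤_) (ℕ.m+n∸n≡m m m) (ℕ.∸-monoˡ-≤ m x≤2m)))

Xpair-ends : ∀ m i → toℕ (proj₁ (Xpair m i)) ≡ lowEnd m (toℕ i)
                   × toℕ (proj₂ (Xpair m i)) ≡ highEnd m (toℕ i)
Xpair-ends m i with splitAt (suc m) i in split≡
... | inj₁ j = subst (λ x → 0 ≡ lowEnd m x × suc (toℕ j) ≡ highEnd m x) (sym i≡j)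
  (sym (ℕ.m≤n⇒m∸n≡0 j≤m) , cong suc (sym (ℕ.m≤n⇒m⊓n≡m j≤m)))
  where
  j≤m = ℕ.≤-pred (toℕ<n j)
  i≡j : toℕ i ≡ toℕ j
  i≡j = trans (sym (cong toℕ (splitAt⁻¹-↑ˡ split≡))) (toℕ-↑ˡ j m)
... | inj₂ k = subst (λ x → suc (toℕ (inject₁ k)) ≡ lowEnd m x × toℕ (fromℕ (suc m)) ≡ highEnd m x) (sym i≡m+k)
  (trans (cong suc (toℕ-inject₁ k))
     (sym (trans (ℕ.+-∸-assoc 1 (ℕ.m≤m+n m (toℕ k))) (cong suc (ℕ.m+n∸m≡n m (toℕ k))))) ,
   trans (toℕ-fromℕ (suc m)) (cong suc (sym (ℕ.m≥n⇒m⊓n≡n (ℕ.m≤n⇒m≤1+n (ℕ.m≤m+n m (toℕ k)))))))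
  where
  i≡m+k : toℕ i ≡ suc m ℕ.+ toℕ k
  i≡m+k = trans (sym (cong toℕ (splitAt⁻¹-↑ʳ split≡))) (toℕ-↑ʳ (suc m) k)

Xunion-pairs : ∀ m i j → Xunion m i j ≡
  proj₁ (Xpair m i) ∷ proj₂ (Xpair m i) ∷ proj₁ (Xpair m j) ∷ proj₂ (Xpair m j) ∷ []
Xunion-pairs m i j with Xpair m i | Xpair m j
... | _ , _ | _ , _ = refl

Xunion-steinerDist-ordered : ∀ m {i j k} → toℕ i ≤ toℕ j → IsSteinerDist (suc m) (Xunion m i j) k →
                             k ℕ.+ lowEnd m (toℕ i) ≡ highEnd m (toℕ j)
Xunion-steinerDist-ordered m {i} {j} {k} i≤j sd with Xpair-ends m i | Xpair-ends m j
... | lo-i , hi-i | lo-j , hi-j =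
  subst₂ (λ a d → k ℕ.+ a ≡ d) lo-i hi-j (steinerDist-orderedPairs
    (subst₂ _≤_ (sym lo-i) (sym hi-i) (lowEnd≤highEnd m (bound i)))
    (subst₂ _≤_ (sym hi-i) (sym hi-j) (s≤s (ℕ.⊓-monoˡ-≤ m i≤j)))
    (subst₂ _≤_ (sym lo-i) (sym lo-j) (ℕ.∸-monoˡ-≤ m i≤j))
    (subst₂ _≤_ (sym lo-j) (sym hi-j) (lowEnd≤highEnd m (bound j)))
    (subst (λ Y → IsSteinerDist (suc m) Y k) (Xunion-pairs m i j) sd))
  where
  bound : (x : Fin (suc m ℕ.+ m)) → toℕ x ≤ m ℕ.+ m
  bound x = ℕ.≤-pred (toℕ<n x)

Xunion-steinerDist-swap : ∀ m i j {k} → IsSteinerDist (suc m) (Xunion m i j) k →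
                          IsSteinerDist (suc m) (Xunion m j i) k
Xunion-steinerDist-swap m i j {k} sd = subst (λ Y → IsSteinerDist (suc m) Y k) (sym (Xunion-pairs m j i))
  (steinerDist-swapPairs (subst (λ Y → IsSteinerDist (suc m) Y k) (Xunion-pairs m i j) sd))

Xunion-steinerDist : ∀ m i j {k} → IsSteinerDist (suc m) (Xunion m i j) k →
                     k ℕ.+ lowEnd m (toℕ i ⊓ toℕ j) ≡ highEnd m (toℕ i ⊔ toℕ j)
Xunion-steinerDist m i j sd with ≤-total (toℕ i) (toℕ j)
... | inj₁ i≤j rewrite ℕ.m≤n⇒m⊓n≡m i≤j | ℕ.m≤n⇒m⊔n≡n i≤j = Xunion-steinerDist-ordered m i≤j sd
... | inj₂ j≤i rewrite ℕ.m≥n⇒m⊓n≡n j≤i | ℕ.m≥n⇒m⊔n≡m j≤i =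
  Xunion-steinerDist-ordered m j≤i (Xunion-steinerDist-swap m i j sd)

-- A separate scope, so that ℚ's _+_ does not clash with ℕ's _+_ in the statement of mainTheorem2.
module _ where

  open import Data.Bool using (if_then_else_)
  open import Data.Integer as ℤ using (+_; _◃_)
  import Data.Integer.Properties as ℤ
  open import Data.Nat.Coprimality as Coprime using (1-coprimeTo)
  open import Data.Rational using (ℚ; mkℚ; 0ℚ; 1ℚ; _+_; _*_; -_; _-_; _/_)
  open import Data.Rational.Properties as ℚ using (+-*-commutativeRing)
  open import Data.Sign using (Sign)
  open import Level using (0ℓ)
  open import Relation.Binary using (tri<; tri≈; tri>)
  open import Relation.Nullary using (Dec; does; ¬_; _⊎-dec_)
  open import Relation.Nullary.Decidable using (dec-true; dec-false; dec⇒maybe)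
  open import Tactic.RingSolver using (solve-∀)
  open import Tactic.RingSolver.Core.AlmostCommutativeRing using (AlmostCommutativeRing; fromCommutativeRing)

  ℚ-ring : AlmostCommutativeRing 0ℓ 0ℓ
  ℚ-ring = fromCommutativeRing +-*-commutativeRing (λ x → dec⇒maybe (0ℚ ℚ.≟ x))

  ι : ℕ → ℚ
  ι a = + a / 1

  ι≡mkℚ : ∀ a → ι a ≡ mkℚ (+ a) 0 (Coprime.sym (1-coprimeTo a))
  ι≡mkℚ a = ℚ.normalize-coprime (Coprime.sym (1-coprimeTo a))

  ι-+ : ∀ a b → ι (a ℕ.+ b) ≡ ι a + ι b
  ι-+ a b rewrite ι≡mkℚ a | ι≡mkℚ b = cong (_/ 1) (sym (cong₂ ℤ._+_ (+◃n*1 a) (+◃n*1 b)))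
    where
    +◃n*1 : ∀ n → Sign.+ ◃ (n ℕ.* 1) ≡ + n
    +◃n*1 n = trans (ℤ.+◃n≡+n (n ℕ.* 1)) (cong +_ (ℕ.*-identityʳ n))

  ι-suc : ∀ a → ι (suc a) ≡ 1ℚ + ι a
  ι-suc = ι-+ 1

  m+n≡o⇒ιm≡ιo-ιn : ∀ {m n o} → m ℕ.+ n ≡ o → ι m ≡ ι o - ι n
  m+n≡o⇒ιm≡ιo-ιn {m} {n} refl = trans (sym (cancel (ι m) (ι n))) (cong (_- ι n) (sym (ι-+ m n)))
    where
    cancel : ∀ a b → a + b - b ≡ a
    cancel = solve-∀ ℚ-ring

  1/[1+n]*[1+n]≡1 : ∀ n → (+ 1 / suc n) * ι (suc n) ≡ 1ℚ
  1/[1+n]*[1+n]≡1 n rewrite ι≡mkℚ (suc n) | ℚ.normalize-coprime {1} {n} (1-coprimeTo (suc n)) =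
    ℚ.*-inverseˡ (mkℚ (+ suc n) 0 (Coprime.sym (1-coprimeTo (suc n))))

  ⟦_⟧ : ∀ {P : Set} → Dec P → ℚ
  ⟦ P? ⟧ = if does P? then 1ℚ else 0ℚ

  ⟦⟧-yes : ∀ {P : Set} (P? : Dec P) → P → ⟦ P? ⟧ ≡ 1ℚ
  ⟦⟧-yes P? p rewrite dec-true P? p = refl

  ⟦⟧-no : ∀ {P : Set} (P? : Dec P) → ¬ P → ⟦ P? ⟧ ≡ 0ℚ
  ⟦⟧-no P? ¬p rewrite dec-false P? ¬p = refl

  ⟦⟧-cong : ∀ {P Q : Set} (P? : Dec P) (Q? : Dec Q) → (P → Q) → (Q → P) → ⟦ P? ⟧ ≡ ⟦ Q? ⟧
  ⟦⟧-cong (yes p) Q? P→Q Q→P = sym (⟦⟧-yes Q? (P→Q p))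
  ⟦⟧-cong (no ¬p) Q? P→Q Q→P = sym (⟦⟧-no Q? (λ q → ¬p (Q→P q)))

  ⟦≟⟧-sym : ∀ a b → ⟦ a ℕ.≟ b ⟧ ≡ ⟦ b ℕ.≟ a ⟧
  ⟦≟⟧-sym a b = ⟦⟧-cong (a ℕ.≟ b) (b ℕ.≟ a) sym sym

  ⟦⊎⟧≡⟦⟧+⟦⟧ : ∀ {P Q : Set} (P? : Dec P) (Q? : Dec Q) → (P → ¬ Q) → ⟦ P? ⊎-dec Q? ⟧ ≡ ⟦ P? ⟧ + ⟦ Q? ⟧
  ⟦⊎⟧≡⟦⟧+⟦⟧ (yes p) (yes q) P→¬Q = ⊥-elim (P→¬Q p q)
  ⟦⊎⟧≡⟦⟧+⟦⟧ (yes p) (no _)  _    = refl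
  ⟦⊎⟧≡⟦⟧+⟦⟧ (no _)  (yes q) _    = refl
  ⟦⊎⟧≡⟦⟧+⟦⟧ (no _)  (no _)  _    = refl

  ⟦≤⟧≡⟦<⟧+⟦≡⟧ : ∀ a b → ⟦ a ℕ.≤? b ⟧ ≡ ⟦ a ℕ.<? b ⟧ + ⟦ a ℕ.≟ b ⟧
  ⟦≤⟧≡⟦<⟧+⟦≡⟧ a b with ℕ.<-cmp a b
  ... | tri< a<b a≢b _ rewrite dec-true (a ℕ.≤? b) (ℕ.<⇒≤ a<b) | dec-true (a ℕ.<? b) a<b
                             | dec-false (a ℕ.≟ b) a≢b = sym (ℚ.+-identityʳ 1ℚ)
  ... | tri≈ a≮b refl _ rewrite dec-true (a ℕ.≤? a) ≤-refl | dec-false (a ℕ.<? a) a≮b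
                              | dec-true (a ℕ.≟ a) refl = refl
  ... | tri> _ a≢b b<a rewrite dec-false (a ℕ.≤? b) (ℕ.<⇒≱ b<a) | dec-false (a ℕ.<? b) (ℕ.<⇒≯ b<a)
                             | dec-false (a ℕ.≟ b) a≢b = refl

  ⟦≤1+⟧≡⟦≤⟧+⟦≡1+⟧ : ∀ x y → ⟦ x ℕ.≤? suc y ⟧ ≡ ⟦ x ℕ.≤? y ⟧ + ⟦ x ℕ.≟ suc y ⟧
  ⟦≤1+⟧≡⟦≤⟧+⟦≡1+⟧ x y = trans (⟦≤⟧≡⟦<⟧+⟦≡⟧ x (suc y))
    (cong (_+ ⟦ x ℕ.≟ suc y ⟧) (⟦⟧-cong (x ℕ.<? suc y) (x ℕ.≤? y) ℕ.≤-pred s≤s))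

  ⟦≤0⟧≡⟦≡0⟧ : ∀ x → ⟦ x ℕ.≤? 0 ⟧ ≡ ⟦ x ℕ.≟ 0 ⟧
  ⟦≤0⟧≡⟦≡0⟧ x = ⟦⟧-cong (x ℕ.≤? 0) (x ℕ.≟ 0) ℕ.n≤0⇒n≡0 ℕ.≤-reflexive

  sumFin-cong : ∀ N {f g : Fin N → ℚ} → (∀ k → f k ≡ g k) → sumFin N f ≡ sumFin N g
  sumFin-cong zero    f≡g = refl
  sumFin-cong (suc N) f≡g = cong₂ _+_ (f≡g zero) (sumFin-cong N (λ k → f≡g (suc k)))

  sumFin-+ : ∀ N (f g : Fin N → ℚ) → sumFin N (λ k → f k + g k) ≡ sumFin N f + sumFin N g
  sumFin-+ zero    f g = refl
  sumFin-+ (suc N) f g rewrite sumFin-+ N (λ k → f (suc k)) (λ k → g (suc k)) =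
    interchange (f zero) (g zero) (sumFin N (λ k → f (suc k))) (sumFin N (λ k → g (suc k)))
    where
    interchange : ∀ a b c d → (a + b) + (c + d) ≡ (a + c) + (b + d)
    interchange = solve-∀ ℚ-ring

  sumFin-− : ∀ N (f g : Fin N → ℚ) → sumFin N (λ k → f k - g k) ≡ sumFin N f - sumFin N g
  sumFin-− zero    f g = refl
  sumFin-− (suc N) f g rewrite sumFin-− N (λ k → f (suc k)) (λ k → g (suc k)) =
    interchange (f zero) (g zero) (sumFin N (λ k → f (suc k))) (sumFin N (λ k → g (suc k)))
    where
    interchange : ∀ a b c d → (a - b) + (c - d) ≡ (a + c) - (b + d)
    interchange = solve-∀ ℚ-ring

  sumFin-*ˡ : ∀ N c (f : Fin N → ℚ) → sumFin N (λ k → c * f k) ≡ c * sumFin N f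
  sumFin-*ˡ zero    c f = sym (ℚ.*-zeroʳ c)
  sumFin-*ˡ (suc N) c f rewrite sumFin-*ˡ N c (λ k → f (suc k)) =
    sym (ℚ.*-distribˡ-+ c (f zero) (sumFin N (λ k → f (suc k))))

  sumFin-pointMass : ∀ N t (F : ℕ → ℚ) → sumFin N (λ k → ⟦ toℕ k ℕ.≟ t ⟧ * F (toℕ k)) ≡ ⟦ t ℕ.<? N ⟧ * F t
  sumFin-pointMass zero    t       F = sym (ℚ.*-zeroˡ (F t))
  sumFin-pointMass (suc N) zero    F rewrite sumFin-*ˡ N 0ℚ (λ k → F (suc (toℕ k))) | ℚ.*-zeroˡ (sumFin N (λ k → F (suc (toℕ k)))) =
    ℚ.+-identityʳ (1ℚ * F 0)
  sumFin-pointMass (suc N) (suc t) F rewrite sumFin-pointMass N t (λ x → F (suc x)) | ℚ.*-zeroˡ (F 0) = ℚ.+-identityˡ _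

  Symmetric : ∀ {N} → Matrix N → Set
  Symmetric A = ∀ i j → A i j ≡ A j i

  ⊗-congˡ : ∀ {N} {A A′ : Matrix N} (B : Matrix N) → (∀ i j → A i j ≡ A′ i j) →
            ∀ i j → (A ⊗ B) i j ≡ (A′ ⊗ B) i j
  ⊗-congˡ {N} B A≡A′ i j = sumFin-cong N (λ k → cong (_* B k j) (A≡A′ i k))

  ⊗-congʳ : ∀ {N} (A : Matrix N) {B B′ : Matrix N} → (∀ i j → B i j ≡ B′ i j) →
            ∀ i j → (A ⊗ B) i j ≡ (A ⊗ B′) i j
  ⊗-congʳ {N} A B≡B′ i j = sumFin-cong N (λ k → cong (A i k *_) (B≡B′ k j))

  ⊗-transpose : ∀ {N} {A B : Matrix N} → Symmetric A → Symmetric B → ∀ i j → (A ⊗ B) i j ≡ (B ⊗ A) j i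
  ⊗-transpose {N} {A} {B} A-sym B-sym i j =
    sumFin-cong N (λ k → trans (cong₂ _*_ (A-sym i k) (B-sym k j)) (ℚ.*-comm (A k i) (B j k)))

  identity≡⟦≟⟧ : ∀ N (i j : Fin N) → identity N i j ≡ ⟦ toℕ i ℕ.≟ toℕ j ⟧
  identity≡⟦≟⟧ N i j with i Fin.≟ j
  ... | yes refl = sym (⟦⟧-yes (toℕ i ℕ.≟ toℕ i) refl)
  ... | no  i≢j  = sym (⟦⟧-no (toℕ i ℕ.≟ toℕ j) (λ i≡j → i≢j (toℕ-injective i≡j)))

  identity-sym : ∀ N → Symmetric (identity N)
  identity-sym N i j = trans (identity≡⟦≟⟧ N i j) (trans (⟦≟⟧-sym (toℕ i) (toℕ j)) (sym (identity≡⟦≟⟧ N j i)))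

  adjℚ-neighbours : ∀ {N} (k j : Fin N) → adjℚ k j ≡ ⟦ suc (toℕ k) ℕ.≟ toℕ j ⟧ + ⟦ suc (toℕ j) ℕ.≟ toℕ k ⟧
  adjℚ-neighbours k j = trans adjℚ≡⟦pathAdj⟧ (⟦⊎⟧≡⟦⟧+⟦⟧ (suc (toℕ k) ℕ.≟ toℕ j) (suc (toℕ j) ℕ.≟ toℕ k) noTwoCycle)
    where
    adjℚ≡⟦pathAdj⟧ : adjℚ k j ≡ ⟦ pathAdj? k j ⟧
    adjℚ≡⟦pathAdj⟧ with pathAdj? k j
    ... | yes k~j = sym (⟦⟧-yes (pathAdj? k j) k~j)
    ... | no  k≁j = sym (⟦⟧-no (pathAdj? k j) k≁j)
    noTwoCycle : suc (toℕ k) ≡ toℕ j → suc (toℕ j) ≢ toℕ k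
    noTwoCycle k+1≡j j+1≡k = ℕ.<-irrefl refl
      (subst (toℕ k <_) (trans (cong suc k+1≡j) j+1≡k) (ℕ.m<n⇒m<1+n (ℕ.n<1+n (toℕ k))))

  adjℚ-sym : ∀ {N} (k j : Fin N) → adjℚ k j ≡ adjℚ j k
  adjℚ-sym k j = trans (adjℚ-neighbours k j)
    (trans (ℚ.+-comm ⟦ suc (toℕ k) ℕ.≟ toℕ j ⟧ ⟦ suc (toℕ j) ℕ.≟ toℕ k ⟧) (sym (adjℚ-neighbours j k)))

  adjℚ-irrefl : ∀ {N} (j : Fin N) → adjℚ j j ≡ 0ℚ
  adjℚ-irrefl j = trans (adjℚ-neighbours j j)
    (cong₂ _+_ (⟦⟧-no (suc (toℕ j) ℕ.≟ toℕ j) ℕ.1+n≢n) (⟦⟧-no (suc (toℕ j) ℕ.≟ toℕ j) ℕ.1+n≢n))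

  neg-laplacianPath : ∀ N (k j : Fin N) → - laplacianPath N k j ≡ adjℚ k j - ⟦ toℕ k ℕ.≟ toℕ j ⟧ * degree j
  neg-laplacianPath N k j with k Fin.≟ j
  ... | yes refl rewrite adjℚ-irrefl k | ⟦⟧-yes (toℕ k ℕ.≟ toℕ k) refl = diagonal (degree k)
    where
    diagonal : ∀ d → - d ≡ 0ℚ - 1ℚ * d
    diagonal = solve-∀ ℚ-ring
  ... | no  k≢j  rewrite ⟦⟧-no (toℕ k ℕ.≟ toℕ j) (λ k≡j → k≢j (toℕ-injective k≡j)) =
    offDiagonal (adjℚ k j) (degree j)
    where
    offDiagonal : ∀ a d → - (- a) ≡ a - 0ℚ * d
    offDiagonal = solve-∀ ℚ-ring

  laplacianPath-sym : ∀ N → Symmetric (laplacianPath N)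
  laplacianPath-sym N i j with i Fin.≟ j | j Fin.≟ i
  ... | yes refl | yes _    = refl
  ... | yes refl | no  i≢i  = ⊥-elim (i≢i refl)
  ... | no  i≢i  | yes refl = ⊥-elim (i≢i refl)
  ... | no  _    | no  _    = cong -_ (adjℚ-sym i j)

  secondDifference : ∀ N → (ℕ → ℚ) → ℕ → ℚ
  secondDifference N F y = sumFin N (λ k → ⟦ suc (toℕ k) ℕ.≟ y ⟧ * (F (toℕ k) - F y))
                         + sumFin N (λ k → ⟦ toℕ k ℕ.≟ suc y ⟧ * (F (toℕ k) - F y))

  sumFin-adjℚ≡secondDifference : ∀ N (F : ℕ → ℚ) (j : Fin N) →
    sumFin N (λ k → adjℚ k j * (F (toℕ k) - F (toℕ j))) ≡ secondDifference N F (toℕ j)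
  sumFin-adjℚ≡secondDifference N F j = trans (sumFin-cong N split) (sumFin-+ N _ _)
    where
    G = λ z → F z - F (toℕ j)
    split : ∀ k → adjℚ k j * G (toℕ k) ≡ ⟦ suc (toℕ k) ℕ.≟ toℕ j ⟧ * G (toℕ k) + ⟦ toℕ k ℕ.≟ suc (toℕ j) ⟧ * G (toℕ k)
    split k = trans (cong (_* G (toℕ k)) (trans (adjℚ-neighbours k j)
                      (cong (λ s → ⟦ suc (toℕ k) ℕ.≟ toℕ j ⟧ + s) (⟦≟⟧-sym (suc (toℕ j)) (toℕ k)))))
                    (ℚ.*-distribʳ-+ (G (toℕ k)) ⟦ suc (toℕ k) ℕ.≟ toℕ j ⟧ ⟦ toℕ k ℕ.≟ suc (toℕ j) ⟧)

  sumFin-*-neg-laplacianPath : ∀ N (F : ℕ → ℚ) (j : Fin N) →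
    sumFin N (λ k → F (toℕ k) * - laplacianPath N k j) ≡ secondDifference N F (toℕ j)
  sumFin-*-neg-laplacianPath N F j = begin
    sumFin N (λ k → F (toℕ k) * - laplacianPath N k j)
      ≡⟨ sumFin-cong N (λ k → trans (cong (F (toℕ k) *_) (neg-laplacianPath N k j))
                                    (expand (F (toℕ k)) (adjℚ k j) ⟦ toℕ k ℕ.≟ toℕ j ⟧ (degree j))) ⟩
    sumFin N (λ k → adjℚ k j * F (toℕ k) - ⟦ toℕ k ℕ.≟ toℕ j ⟧ * (degree j * F (toℕ k)))
      ≡⟨ sumFin-− N _ _ ⟩
    sumFin N (λ k → adjℚ k j * F (toℕ k)) - sumFin N (λ k → ⟦ toℕ k ℕ.≟ toℕ j ⟧ * (degree j * F (toℕ k)))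
      ≡⟨ cong (λ s → sumFin N (λ k → adjℚ k j * F (toℕ k)) - s) diagonal ⟩
    sumFin N (λ k → adjℚ k j * F (toℕ k)) - sumFin N (λ k → F (toℕ j) * adjℚ k j)
      ≡⟨ sumFin-− N _ _ ⟨
    sumFin N (λ k → adjℚ k j * F (toℕ k) - F (toℕ j) * adjℚ k j)
      ≡⟨ sumFin-cong N (λ k → factor (adjℚ k j) (F (toℕ k)) (F (toℕ j))) ⟩
    sumFin N (λ k → adjℚ k j * (F (toℕ k) - F (toℕ j)))
      ≡⟨ sumFin-adjℚ≡secondDifference N F j ⟩
    secondDifference N F (toℕ j) ∎
    where
    open ≡-Reasoning
    expand : ∀ f a e d → f * (a - e * d) ≡ a * f - e * (d * f)
    expand = solve-∀ ℚ-ring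
    factor : ∀ a f g → a * f - g * a ≡ a * (f - g)
    factor = solve-∀ ℚ-ring
    diagonal : sumFin N (λ k → ⟦ toℕ k ℕ.≟ toℕ j ⟧ * (degree j * F (toℕ k))) ≡ sumFin N (λ k → F (toℕ j) * adjℚ k j)
    diagonal = begin
      sumFin N (λ k → ⟦ toℕ k ℕ.≟ toℕ j ⟧ * (degree j * F (toℕ k)))
        ≡⟨ sumFin-pointMass N (toℕ j) (λ x → degree j * F x) ⟩
      ⟦ toℕ j ℕ.<? N ⟧ * (degree j * F (toℕ j))
        ≡⟨ cong (_* (degree j * F (toℕ j))) (⟦⟧-yes (toℕ j ℕ.<? N) (toℕ<n j)) ⟩
      1ℚ * (degree j * F (toℕ j))
        ≡⟨ trans (ℚ.*-identityˡ _) (ℚ.*-comm (degree j) (F (toℕ j))) ⟩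
      F (toℕ j) * degree j
        ≡⟨ cong (F (toℕ j) *_) (sumFin-cong N (adjℚ-sym j)) ⟩
      F (toℕ j) * sumFin N (λ k → adjℚ k j)
        ≡⟨ sumFin-*ˡ N (F (toℕ j)) (λ k → adjℚ k j) ⟨
      sumFin N (λ k → F (toℕ j) * adjℚ k j) ∎

  uVec≡⟦≟⟧ : ∀ m k → uVec m k ≡ ⟦ toℕ k ℕ.≟ m ⟧
  uVec≡⟦≟⟧ m k with toℕ k ℕ.≟ m
  ... | yes k≡m = sym (⟦⟧-yes (toℕ k ℕ.≟ m) k≡m)
  ... | no  k≢m = sym (⟦⟧-no (toℕ k ℕ.≟ m) k≢m)

  claimedInverse-sym : ∀ m → Symmetric (claimedInverse m)
  claimedInverse-sym m i j =
    cong₂ _+_ (cong -_ (laplacianPath-sym (suc m ℕ.+ m) i j)) (cong (+ 1 / suc m *_) (ℚ.*-comm (uVec m i) (uVec m j)))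

  pairDist : ℕ → ℕ → ℕ → ℚ
  pairDist m x y = ι (highEnd m (x ⊔ y)) - ι (lowEnd m (x ⊓ y))

  pairDist-sym : ∀ m x y → pairDist m x y ≡ pairDist m y x
  pairDist-sym m x y rewrite ℕ.⊔-comm x y | ℕ.⊓-comm x y = refl

  highEnd-suc : ∀ m z → ι (highEnd m (suc z)) ≡ ι (highEnd m z) + ⟦ z ℕ.<? m ⟧
  highEnd-suc m z with z ℕ.<? m
  ... | yes z<m rewrite ℕ.m≤n⇒m⊓n≡m z<m | ℕ.m≤n⇒m⊓n≡m (ℕ.<⇒≤ z<m) | ⟦⟧-yes (z ℕ.<? m) z<m =
    trans (ι-suc (suc z)) (ℚ.+-comm 1ℚ (ι (suc z)))
  ... | no  z≮m rewrite ℕ.m≥n⇒m⊓n≡n (ℕ.≮⇒≥ z≮m) | ℕ.m≥n⇒m⊓n≡n (ℕ.m≤n⇒m≤1+n (ℕ.≮⇒≥ z≮m)) | ⟦⟧-no (z ℕ.<? m) z≮m =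
    sym (ℚ.+-identityʳ (ι (suc m)))

  lowEnd-suc : ∀ m z → ι (lowEnd m (suc z)) ≡ ι (lowEnd m z) + 1ℚ - ⟦ z ℕ.<? m ⟧
  lowEnd-suc m z with z ℕ.<? m
  ... | yes z<m rewrite ℕ.m≤n⇒m∸n≡0 z<m | ℕ.m≤n⇒m∸n≡0 (ℕ.<⇒≤ z<m) | ⟦⟧-yes (z ℕ.<? m) z<m = refl
  ... | no  z≮m rewrite ℕ.+-∸-assoc 1 (ℕ.≮⇒≥ z≮m) | ⟦⟧-no (z ℕ.<? m) z≮m =
    trans (ι-suc (z ∸ m)) (comm (ι (z ∸ m)))
    where
    comm : ∀ a → 1ℚ + a ≡ a + 1ℚ - 0ℚ
    comm = solve-∀ ℚ-ring

  pairDist-slope : ∀ m x z → pairDist m x (suc z) - pairDist m x z ≡ ⟦ x ℕ.≤? z ⟧ + ⟦ z ℕ.<? m ⟧ - 1ℚ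
  pairDist-slope m x z with x ℕ.≤? z
  ... | yes x≤z rewrite ℕ.m≤n⇒m⊔n≡n x≤z | ℕ.m≤n⇒m⊔n≡n (ℕ.m≤n⇒m≤1+n x≤z)
                      | ℕ.m≤n⇒m⊓n≡m x≤z | ℕ.m≤n⇒m⊓n≡m (ℕ.m≤n⇒m≤1+n x≤z) | highEnd-suc m z
                      | ⟦⟧-yes (x ℕ.≤? z) x≤z =
    ascending (ι (highEnd m z)) (ι (lowEnd m x)) ⟦ z ℕ.<? m ⟧
    where
    ascending : ∀ h l d → (h + d - l) - (h - l) ≡ 1ℚ + d - 1ℚ
    ascending = solve-∀ ℚ-ring
  ... | no  x≰z rewrite ℕ.m≥n⇒m⊔n≡m (ℕ.≰⇒> x≰z) | ℕ.m≥n⇒m⊔n≡m (ℕ.<⇒≤ (ℕ.≰⇒> x≰z))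
                      | ℕ.m≥n⇒m⊓n≡n (ℕ.≰⇒> x≰z) | ℕ.m≥n⇒m⊓n≡n (ℕ.<⇒≤ (ℕ.≰⇒> x≰z)) | lowEnd-suc m z
                      | ⟦⟧-no (x ℕ.≤? z) x≰z =
    descending (ι (highEnd m x)) (ι (lowEnd m z)) ⟦ z ℕ.<? m ⟧
    where
    descending : ∀ h l d → (h - (l + 1ℚ - d)) - (h - l) ≡ 0ℚ + d - 1ℚ
    descending = solve-∀ ℚ-ring

  pairDist-at-m : ∀ m x → pairDist m x m ≡ ι (suc m)
  pairDist-at-m m x rewrite ℕ.m≥n⇒m⊓n≡n (ℕ.m≤n⊔m x m) | ℕ.m≤n⇒m∸n≡0 (ℕ.m⊓n≤n x m) = ℚ.+-identityʳ (ι (suc m))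

  pairDist-forwardDifference : ∀ m x y → x ≤ m ℕ.+ m →
    ⟦ suc y ℕ.<? suc m ℕ.+ m ⟧ * (pairDist m x (suc y) - pairDist m x y) ≡ ⟦ x ℕ.≤? y ⟧ + ⟦ y ℕ.<? m ⟧ - 1ℚ
  pairDist-forwardDifference m x y x≤2m with suc y ℕ.<? suc m ℕ.+ m
  ... | yes y+1<N rewrite ⟦⟧-yes (suc y ℕ.<? suc m ℕ.+ m) y+1<N =
    trans (ℚ.*-identityˡ (pairDist m x (suc y) - pairDist m x y)) (pairDist-slope m x y)
  ... | no  y+1≮N with ℕ.≤-pred (ℕ.≮⇒≥ y+1≮N)
  ...   | 2m≤y rewrite ⟦⟧-no (suc y ℕ.<? suc m ℕ.+ m) y+1≮N | ⟦⟧-yes (x ℕ.≤? y) (≤-trans x≤2m 2m≤y)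
                     | ⟦⟧-no (y ℕ.<? m) (ℕ.≤⇒≯ (≤-trans (ℕ.m≤m+n m m) 2m≤y)) =
    ℚ.*-zeroˡ (pairDist m x (suc y) - pairDist m x y)

  pairDist-backwardDifference : ∀ m x y → y < suc m ℕ.+ m →
    ⟦ y ℕ.<? suc m ℕ.+ m ⟧ * (pairDist m x y - pairDist m x (suc y)) ≡ - (⟦ x ℕ.≤? y ⟧ + ⟦ y ℕ.<? m ⟧ - 1ℚ)
  pairDist-backwardDifference m x y y<N rewrite ⟦⟧-yes (y ℕ.<? suc m ℕ.+ m) y<N =
    trans (negate (pairDist m x y) (pairDist m x (suc y))) (cong -_ (pairDist-slope m x y))
    where
    negate : ∀ a b → 1ℚ * (a - b) ≡ - (b - a)
    negate = solve-∀ ℚ-ring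

  -- Both clauses start from the goal after ⟦ suc a ℕ.≟ b ⟧ has computed on the shape of b.
  pairDist-secondDifference : ∀ m x y → x ≤ m ℕ.+ m → y < suc m ℕ.+ m →
    secondDifference (suc m ℕ.+ m) (pairDist m x) y + ⟦ y ℕ.≟ m ⟧ ≡ ⟦ x ℕ.≟ y ⟧
  pairDist-secondDifference m x zero x≤2m _ = begin
    sumFin N (λ k → 0ℚ * G (toℕ k)) + sumFin N (λ k → ⟦ toℕ k ℕ.≟ 1 ⟧ * G (toℕ k)) + ⟦ 0 ℕ.≟ m ⟧
      ≡⟨ cong₂ (λ b f → b + f + ⟦ 0 ℕ.≟ m ⟧)
               (trans (sumFin-*ˡ N 0ℚ (λ k → G (toℕ k))) (ℚ.*-zeroˡ (sumFin N (λ k → G (toℕ k)))))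
               (trans (sumFin-pointMass N 1 G) (pairDist-forwardDifference m x 0 x≤2m)) ⟩
    0ℚ + (⟦ x ℕ.≤? 0 ⟧ + ⟦ 0 ℕ.<? m ⟧ - 1ℚ) + ⟦ 0 ℕ.≟ m ⟧
      ≡⟨ regroup ⟦ x ℕ.≤? 0 ⟧ ⟦ 0 ℕ.<? m ⟧ ⟦ 0 ℕ.≟ m ⟧ ⟩
    ⟦ x ℕ.≤? 0 ⟧ + (⟦ 0 ℕ.<? m ⟧ + ⟦ 0 ℕ.≟ m ⟧) - 1ℚ
      ≡⟨ cong (λ s → ⟦ x ℕ.≤? 0 ⟧ + s - 1ℚ) (⟦≤⟧≡⟦<⟧+⟦≡⟧ 0 m) ⟨
    ⟦ x ℕ.≤? 0 ⟧ + 1ℚ - 1ℚ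
      ≡⟨ cancel ⟦ x ℕ.≤? 0 ⟧ ⟩
    ⟦ x ℕ.≤? 0 ⟧
      ≡⟨ ⟦≤0⟧≡⟦≡0⟧ x ⟩
    ⟦ x ℕ.≟ 0 ⟧ ∎
    where
    open ≡-Reasoning
    N = suc m ℕ.+ m
    G = λ z → pairDist m x z - pairDist m x 0
    regroup : ∀ a p q → 0ℚ + (a + p - 1ℚ) + q ≡ a + (p + q) - 1ℚ
    regroup = solve-∀ ℚ-ring
    cancel : ∀ a → a + 1ℚ - 1ℚ ≡ a
    cancel = solve-∀ ℚ-ring
  pairDist-secondDifference m x (suc y) x≤2m y+1<N = begin
    sumFin N (λ k → ⟦ toℕ k ℕ.≟ y ⟧ * G (toℕ k)) + sumFin N (λ k → ⟦ toℕ k ℕ.≟ suc (suc y) ⟧ * G (toℕ k))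
      + ⟦ suc y ℕ.≟ m ⟧
      ≡⟨ cong₂ (λ b f → b + f + ⟦ suc y ℕ.≟ m ⟧)
               (trans (sumFin-pointMass N y G) (pairDist-backwardDifference m x y (ℕ.<-trans (ℕ.n<1+n y) y+1<N)))
               (trans (sumFin-pointMass N (suc (suc y)) G) (pairDist-forwardDifference m x (suc y) x≤2m)) ⟩
    - (⟦ x ℕ.≤? y ⟧ + ⟦ y ℕ.<? m ⟧ - 1ℚ) + (⟦ x ℕ.≤? suc y ⟧ + ⟦ suc y ℕ.<? m ⟧ - 1ℚ) + ⟦ suc y ℕ.≟ m ⟧
      ≡⟨ cong₂ (λ p a → - (⟦ x ℕ.≤? y ⟧ + p - 1ℚ) + (a + ⟦ suc y ℕ.<? m ⟧ - 1ℚ) + ⟦ suc y ℕ.≟ m ⟧)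
               (⟦≤⟧≡⟦<⟧+⟦≡⟧ (suc y) m) (⟦≤1+⟧≡⟦≤⟧+⟦≡1+⟧ x y) ⟩
    - (⟦ x ℕ.≤? y ⟧ + (⟦ suc y ℕ.<? m ⟧ + ⟦ suc y ℕ.≟ m ⟧) - 1ℚ)
      + (⟦ x ℕ.≤? y ⟧ + ⟦ x ℕ.≟ suc y ⟧ + ⟦ suc y ℕ.<? m ⟧ - 1ℚ) + ⟦ suc y ℕ.≟ m ⟧
      ≡⟨ telescope ⟦ x ℕ.≤? y ⟧ ⟦ suc y ℕ.<? m ⟧ ⟦ suc y ℕ.≟ m ⟧ ⟦ x ℕ.≟ suc y ⟧ ⟩
    ⟦ x ℕ.≟ suc y ⟧ ∎
    where
    open ≡-Reasoning
    N = suc m ℕ.+ m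
    G = λ z → pairDist m x z - pairDist m x (suc y)
    telescope : ∀ a p q e → - (a + (p + q) - 1ℚ) + (a + e + p - 1ℚ) + q ≡ e
    telescope = solve-∀ ℚ-ring

  sumFin-pairDist-*-uu′ : ∀ m x (j : Fin (suc m ℕ.+ m)) →
    sumFin (suc m ℕ.+ m) (λ k → pairDist m x (toℕ k) * ((+ 1 / suc m) * (uVec m k * uVec m j))) ≡ uVec m j
  sumFin-pairDist-*-uu′ m x j = begin
    sumFin N (λ k → pairDist m x (toℕ k) * (c * (uVec m k * uVec m j)))
      ≡⟨ sumFin-cong N (λ k → trans (cong (λ u → pairDist m x (toℕ k) * (c * (u * uVec m j))) (uVec≡⟦≟⟧ m k))
                                    (rearrange (pairDist m x (toℕ k)) c ⟦ toℕ k ℕ.≟ m ⟧ (uVec m j))) ⟩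
    sumFin N (λ k → (c * uVec m j) * (⟦ toℕ k ℕ.≟ m ⟧ * pairDist m x (toℕ k)))
      ≡⟨ sumFin-*ˡ N (c * uVec m j) (λ k → ⟦ toℕ k ℕ.≟ m ⟧ * pairDist m x (toℕ k)) ⟩
    (c * uVec m j) * sumFin N (λ k → ⟦ toℕ k ℕ.≟ m ⟧ * pairDist m x (toℕ k))
      ≡⟨ cong ((c * uVec m j) *_) (sumFin-pointMass N m (pairDist m x)) ⟩
    (c * uVec m j) * (⟦ m ℕ.<? N ⟧ * pairDist m x m)
      ≡⟨ cong₂ (λ e d → (c * uVec m j) * (e * d)) (⟦⟧-yes (m ℕ.<? N) (s≤s (ℕ.m≤m+n m m))) (pairDist-at-m m x) ⟩
    (c * uVec m j) * (1ℚ * ι (suc m))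
      ≡⟨ regroup c (uVec m j) (ι (suc m)) ⟩
    (c * ι (suc m)) * uVec m j
      ≡⟨ trans (cong (_* uVec m j) (1/[1+n]*[1+n]≡1 m)) (ℚ.*-identityˡ (uVec m j)) ⟩
    uVec m j ∎
    where
    open ≡-Reasoning
    N = suc m ℕ.+ m
    c = + 1 / suc m
    rearrange : ∀ f c e u → f * (c * (e * u)) ≡ (c * u) * (e * f)
    rearrange = solve-∀ ℚ-ring
    regroup : ∀ c u n → (c * u) * (1ℚ * n) ≡ (c * n) * u
    regroup = solve-∀ ℚ-ring

  Dist : ∀ m → Matrix (suc m ℕ.+ m)
  Dist m i j = pairDist m (toℕ i) (toℕ j)

  Dist-sym : ∀ m → Symmetric (Dist m)
  Dist-sym m i j = pairDist-sym m (toℕ i) (toℕ j)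

  Dist⊗claimedInverse : ∀ m i j → (Dist m ⊗ claimedInverse m) i j ≡ identity (suc m ℕ.+ m) i j
  Dist⊗claimedInverse m i j = begin
    sumFin N (λ k → F (toℕ k) * (- laplacianPath N k j + c * (uVec m k * uVec m j)))
      ≡⟨ trans (sumFin-cong N (λ k → ℚ.*-distribˡ-+ (F (toℕ k)) (- laplacianPath N k j) (c * (uVec m k * uVec m j))))
               (sumFin-+ N (λ k → F (toℕ k) * - laplacianPath N k j) (λ k → F (toℕ k) * (c * (uVec m k * uVec m j)))) ⟩
    sumFin N (λ k → F (toℕ k) * - laplacianPath N k j) + sumFin N (λ k → F (toℕ k) * (c * (uVec m k * uVec m j)))
      ≡⟨ cong₂ _+_ (sumFin-*-neg-laplacianPath N F j) (sumFin-pairDist-*-uu′ m (toℕ i) j) ⟩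
    secondDifference N F (toℕ j) + uVec m j
      ≡⟨ cong (λ u → secondDifference N F (toℕ j) + u) (uVec≡⟦≟⟧ m j) ⟩
    secondDifference N F (toℕ j) + ⟦ toℕ j ℕ.≟ m ⟧
      ≡⟨ pairDist-secondDifference m (toℕ i) (toℕ j) (ℕ.≤-pred (toℕ<n i)) (toℕ<n j) ⟩
    ⟦ toℕ i ℕ.≟ toℕ j ⟧
      ≡⟨ identity≡⟦≟⟧ N i j ⟨
    identity N i j ∎
    where
    open ≡-Reasoning
    N = suc m ℕ.+ m
    c = + 1 / suc m
    F = pairDist m (toℕ i)

open import Data.Nat using (_+_)

mainTheorem2 : (m : ℕ) → (d : Fin (suc m + m) → Fin (suc m + m) → ℕ)
    → (∀ i j → IsSteinerDist (suc m) (Xunion m i j) (d i j))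
    → (∀ i j → (toℚMatrix d ⊗ claimedInverse m) i j ≡ identity (suc m + m) i j)
    × (∀ i j → (claimedInverse m ⊗ toℚMatrix d) i j ≡ identity (suc m + m) i j)
mainTheorem2 m d d-steiner = D⊗C , C⊗D
  where
  open ≡-Reasoning
  N = suc m + m
  D≡Dist : ∀ i j → toℚMatrix d i j ≡ Dist m i j
  D≡Dist i j = m+n≡o⇒ιm≡ιo-ιn {n = lowEnd m (toℕ i ⊓ toℕ j)} (Xunion-steinerDist m i j (d-steiner i j))
  D⊗C : ∀ i j → (toℚMatrix d ⊗ claimedInverse m) i j ≡ identity N i j
  D⊗C i j = trans (⊗-congˡ (claimedInverse m) D≡Dist i j) (Dist⊗claimedInverse m i j)
  C⊗D : ∀ i j → (claimedInverse m ⊗ toℚMatrix d) i j ≡ identity N i j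
  C⊗D i j = begin
    (claimedInverse m ⊗ toℚMatrix d) i j ≡⟨ ⊗-congʳ (claimedInverse m) D≡Dist i j ⟩
    (claimedInverse m ⊗ Dist m) i j     ≡⟨ ⊗-transpose (claimedInverse-sym m) (Dist-sym m) i j ⟩
    (Dist m ⊗ claimedInverse m) j i     ≡⟨ Dist⊗claimedInverse m j i ⟩
    identity N j i                      ≡⟨ identity-sym N j i ⟩
    identity N i j                      ∎
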